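{- Let $a$ and $b$ be coprime positive integers. Then \begin{itemize} \item $R_1(ax+by=bz)=\max(a+1,b)$; \item $R_1(ax+ay=z)=2a$; \item if $b>1$, then $R_1(ax+ay=bz)=\max(a,\lceil b/2\rceil)$. \end{itemize}
   Context: For a linear equation $\mathcal{E}$ in the unknowns $x,y,z$ and a positive integer $k$, the $k$-colour Rado number $R_k(\mathcal{E})$ is the smallest positive integer $n$, if it exists, such that every colouring of $\{1,2,\dots,n\}$ with $k$ colours contains a monochromatic solution to $\mathcal{E}$, i.e. a solution $(x,y,z)$ with $x,y,z\in\{1,\dots,n\}$ (not necessarily distinct) all of the same colour. In particular $R_1(\mathcal{E})$ is the smallest $n$ such that $\mathcal{E}$ has a solution with $x,y,z\in\{1,\dots,n\}$. In the paper's notation these equations are $\mathcal{E}(3,0;a,b,b)$, $\mathcal{E}(3,0;a,a,1)$ and $\mathcal{E}(3,0;a,a,b)$. -}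

module Defs where

open import Data.Nat using (ℕ; _+_; _*_; _≤_; _<_; suc)
open import Data.Product using (Σ; _×_)
open import Relation.Binary.PropositionalEquality using (_≡_)
open import Relation.Nullary using (¬_)

Eqn : Set₁
Eqn = ℕ → ℕ → ℕ → Set

E3 : ℕ → ℕ → ℕ → Eqn
E3 c₁ c₂ c₃ x y z = c₁ * x + c₂ * y ≡ c₃ * z

SolIn : Eqn → ℕ → Set
SolIn E n = Σ ℕ λ x → Σ ℕ λ y → Σ ℕ λ z →
  (1 ≤ x × x ≤ n) × (1 ≤ y × y ≤ n) × (1 ≤ z × z ≤ n) × E x y z

R₁≡ : Eqn → ℕ → Set
R₁≡ E n = 1 ≤ n × SolIn E n × (∀ m → 1 ≤ m → m < n → ¬ SolIn E m)

{-# OPTIONS --safe #-}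
-- Each value is attained by an explicit solution: (b, 1, a + 1), (1, 1, 2a) and
-- (⌈b/2⌉, ⌊b/2⌋, a).  For minimality, coprimality does the work: in ax + by = bz
-- it forces b ∣ x, so x ≥ b and then bz ≥ ab + b gives z ≥ a + 1; in
-- a(x + y) = bz it forces a ∣ z and b ∣ x + y, so z ≥ a and 2·max(x, y) ≥ b.
module Submission where

open import Defs
open import Data.Nat using (ℕ; _*_; _≤_; _<_; _⊔_; ⌈_/2⌉; suc)
open import Data.Nat.Coprimality using (Coprime)
open import Data.Product using (_×_)

open import Data.List using ([]; _∷_)
open import Data.Nat using (_+_; ⌊_/2⌋; s≤s; z≤n; >-nonZero)
open import Data.Nat.Coprimality using (coprime-divisor) renaming (sym to coprime-sym)
open import Data.Nat.Divisibility using (_∣_; divides; ∣⇒≤; m∣m*n; ∣m+n∣m⇒∣n)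
open import Data.Nat.Properties
open import Data.Nat.Tactic.RingSolver using (solve)
open import Data.Product using (_,_)
open import Relation.Binary.PropositionalEquality using (_≡_; sym; trans; cong; subst; module ≡-Reasoning)

R₁≡-intro : ∀ {E n} → 1 ≤ n → SolIn E n → (∀ {m} → SolIn E m → n ≤ m) → R₁≡ E n
R₁≡-intro 1≤n sol minimal = 1≤n , sol , λ m _ m<n solₘ → <⇒≱ m<n (minimal solₘ)

∣⇒≤-pos : ∀ {d n} → 1 ≤ n → d ∣ n → d ≤ n
∣⇒≤-pos 1≤n = ∣⇒≤ {{>-nonZero 1≤n}}

⌈n/2⌉≤m : ∀ {n m} → n ≤ m + m → ⌈ n /2⌉ ≤ m
⌈n/2⌉≤m {n} {m} n≤2m = begin
  ⌈ n /2⌉      ≤⟨ ⌈n/2⌉-mono n≤2m ⟩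
  ⌈ m + m /2⌉  ≡⟨ n≡⌈n+n/2⌉ m ⟨
  m            ∎
  where open ≤-Reasoning

abb-b∣x : ∀ {a b} x y z → Coprime a b → E3 a b b x y z → b ∣ x
abb-b∣x {a} {b} x y z coprime eq = coprime-divisor (coprime-sym coprime) b∣ax
  where
  b∣by+ax : b ∣ b * y + a * x
  b∣by+ax = subst (b ∣_) (sym (trans (+-comm (b * y) (a * x)) eq)) (m∣m*n z)

  b∣ax : b ∣ a * x
  b∣ax = ∣m+n∣m⇒∣n b∣by+ax (m∣m*n y)

abb-a<z : ∀ {a b} x y z → 1 ≤ b → b ≤ x → 1 ≤ y → E3 a b b x y z → a < z
abb-a<z {a} {b} x y z 1≤b b≤x 1≤y eq = *-cancelˡ-≤ b {{>-nonZero 1≤b}} (begin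
  b * suc a      ≡⟨ solve (a ∷ b ∷ []) ⟩
  a * b + b * 1  ≤⟨ +-mono-≤ (*-monoʳ-≤ a b≤x) (*-monoʳ-≤ b 1≤y) ⟩
  a * x + b * y  ≡⟨ eq ⟩
  b * z          ∎)
  where open ≤-Reasoning

aa1-2a≤z : ∀ {a} x y z → 1 ≤ x → 1 ≤ y → E3 a a 1 x y z → 2 * a ≤ z
aa1-2a≤z {a} x y z 1≤x 1≤y eq = begin
  2 * a          ≡⟨ *-comm 2 a ⟩
  a * (1 + 1)    ≤⟨ *-monoʳ-≤ a (+-mono-≤ 1≤x 1≤y) ⟩
  a * (x + y)    ≡⟨ *-distribˡ-+ a x y ⟩
  a * x + a * y  ≡⟨ eq ⟩
  1 * z          ≡⟨ *-identityˡ z ⟩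
  z              ∎
  where open ≤-Reasoning

aab-factored : ∀ {a b} x y z → E3 a a b x y z → a * (x + y) ≡ b * z
aab-factored {a} {b} x y z eq = trans (*-distribˡ-+ a x y) eq

aab-a∣z : ∀ {a b} x y z → Coprime a b → E3 a a b x y z → a ∣ z
aab-a∣z {a} {b} x y z coprime eq =
  coprime-divisor coprime (divides (x + y) (sym (trans (*-comm (x + y) a) (aab-factored {a} {b} x y z eq))))

aab-b∣x+y : ∀ {a b} x y z → Coprime a b → E3 a a b x y z → b ∣ x + y
aab-b∣x+y {a} {b} x y z coprime eq =
  coprime-divisor (coprime-sym coprime) (divides z (trans (aab-factored {a} {b} x y z eq) (*-comm b z)))

R₁-abb : ∀ a b → 1 ≤ b → Coprime a b → R₁≡ (E3 a b b) (suc a ⊔ b)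
R₁-abb a b 1≤b coprime = R₁≡-intro (≤-trans (s≤s z≤n) (m≤m⊔n (suc a) b)) witness minimal
  where
  witness : SolIn (E3 a b b) (suc a ⊔ b)
  witness = b , 1 , suc a
    , (1≤b , m≤n⊔m (suc a) b)
    , (s≤s z≤n , ≤-trans (s≤s z≤n) (m≤m⊔n (suc a) b))
    , (s≤s z≤n , m≤m⊔n (suc a) b)
    , solve (a ∷ b ∷ [])

  minimal : ∀ {m} → SolIn (E3 a b b) m → suc a ⊔ b ≤ m
  minimal (x , y , z , (1≤x , x≤m) , (1≤y , _) , (_ , z≤m) , eq) =
    ⊔-lub (≤-trans (abb-a<z {a} {b} x y z 1≤b b≤x 1≤y eq) z≤m) (≤-trans b≤x x≤m)
    where
    b≤x : b ≤ x
    b≤x = ∣⇒≤-pos 1≤x (abb-b∣x x y z coprime eq)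

R₁-aa1 : ∀ a → 1 ≤ a → R₁≡ (E3 a a 1) (2 * a)
R₁-aa1 a 1≤a = R₁≡-intro 1≤2a witness minimal
  where
  1≤2a : 1 ≤ 2 * a
  1≤2a = ≤-trans 1≤a (m≤m+n a (a + 0))

  witness : SolIn (E3 a a 1) (2 * a)
  witness = 1 , 1 , 2 * a , (≤-refl , 1≤2a) , (≤-refl , 1≤2a) , (1≤2a , ≤-refl) , solve (a ∷ [])

  minimal : ∀ {m} → SolIn (E3 a a 1) m → 2 * a ≤ m
  minimal (x , y , z , (1≤x , _) , (1≤y , _) , (_ , z≤m) , eq) =
    ≤-trans (aa1-2a≤z {a} x y z 1≤x 1≤y eq) z≤m

R₁-aab : ∀ a b → 1 ≤ a → 1 < b → Coprime a b → R₁≡ (E3 a a b) (a ⊔ ⌈ b /2⌉)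
R₁-aab a b 1≤a 1<b coprime = R₁≡-intro (≤-trans 1≤a (m≤m⊔n a _)) witness minimal
  where
  1≤⌊b/2⌋ : 1 ≤ ⌊ b /2⌋
  1≤⌊b/2⌋ = ⌊n/2⌋-mono 1<b

  ⌈b/2⌉≤a⊔⌈b/2⌉ : ⌈ b /2⌉ ≤ a ⊔ ⌈ b /2⌉
  ⌈b/2⌉≤a⊔⌈b/2⌉ = m≤n⊔m a _

  halves : a * ⌈ b /2⌉ + a * ⌊ b /2⌋ ≡ b * a
  halves = begin
    a * ⌈ b /2⌉ + a * ⌊ b /2⌋  ≡⟨ *-distribˡ-+ a ⌈ b /2⌉ ⌊ b /2⌋ ⟨
    a * (⌈ b /2⌉ + ⌊ b /2⌋)    ≡⟨ cong (a *_) (+-comm ⌈ b /2⌉ ⌊ b /2⌋) ⟩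
    a * (⌊ b /2⌋ + ⌈ b /2⌉)    ≡⟨ cong (a *_) (⌊n/2⌋+⌈n/2⌉≡n b) ⟩
    a * b                      ≡⟨ *-comm a b ⟩
    b * a                      ∎
    where open ≡-Reasoning

  witness : SolIn (E3 a a b) (a ⊔ ⌈ b /2⌉)
  witness = ⌈ b /2⌉ , ⌊ b /2⌋ , a
    , (≤-trans 1≤⌊b/2⌋ (⌊n/2⌋≤⌈n/2⌉ b) , ⌈b/2⌉≤a⊔⌈b/2⌉)
    , (1≤⌊b/2⌋ , ≤-trans (⌊n/2⌋≤⌈n/2⌉ b) ⌈b/2⌉≤a⊔⌈b/2⌉)
    , (1≤a , m≤m⊔n a _)
    , halves

  minimal : ∀ {m} → SolIn (E3 a a b) m → a ⊔ ⌈ b /2⌉ ≤ m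
  minimal (x , y , z , (1≤x , x≤m) , (_ , y≤m) , (1≤z , z≤m) , eq) =
    ⊔-lub (≤-trans a≤z z≤m) (⌈n/2⌉≤m (≤-trans b≤x+y (+-mono-≤ x≤m y≤m)))
    where
    a≤z : a ≤ z
    a≤z = ∣⇒≤-pos 1≤z (aab-a∣z x y z coprime eq)

    b≤x+y : b ≤ x + y
    b≤x+y = ∣⇒≤-pos (≤-trans 1≤x (m≤m+n x y)) (aab-b∣x+y x y z coprime eq)

lemma1 : (a b : ℕ) → 1 ≤ a → 1 ≤ b → Coprime a b →
    R₁≡ (E3 a b b) ((suc a) ⊔ b)
    × R₁≡ (E3 a a 1) (2 * a)
    × (1 < b → R₁≡ (E3 a a b) (a ⊔ ⌈ b /2⌉))
lemma1 a b 1≤a 1≤b coprime =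
  R₁-abb a b 1≤b coprime , R₁-aa1 a 1≤a , λ 1<b → R₁-aab a b 1≤a 1<b coprime
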